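{- Let $A$ be a cyclically $7$-diagonal partially filled square array of odd size $n\geq 7$ whose nonempty entries are pairwise distinct. Then there exist two compatible orderings $\omega_r$ and $\omega_c$ of the rows and the columns of $A$.
   Context: For a partially filled $n\times n$ array $A=(a_{i,j})$, the cell $(i,j)$ belongs to the diagonal $D_s$ if $j-i\equiv s-1\pmod n$. $A$ is cyclically $k$-diagonal if its nonempty cells are exactly those of the diagonals $D_s$ with $s\in\{r,\dots,r+k-1\}$ (indices mod $n$) for some $r\in\{1,\dots,n\}$. Let $N$ be the number of nonempty cells, whose entries are pairwise distinct. An ordering $\omega_r$ of the rows is a choice of a cyclic ordering of the entries of each row, regarded as a permutation of the set of the $N$ entries (the product of these disjoint cycles, one per row); similarly an ordering $\omega_c$ of the columns. $\omega_r$ and $\omega_c$ are compatible if the permutation $\omega_r\circ\omega_c$ is a single cycle of length $N$. -}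

module Defs where

open import Data.Nat using (ℕ; zero; suc; _+_; _∸_; _<_; NonZero)
open import Data.Nat.DivMod using (_%_)
open import Data.Fin using (Fin; toℕ)
open import Data.Product using (Σ; Σ-syntax; ∃; ∃-syntax; _×_; _,_; proj₁; proj₂)
open import Function.Bundles using (_↔_; Inverse)
open import Relation.Binary.PropositionalEquality using (_≡_)

iter : ∀ {a} {A : Set a} → (A → A) → ℕ → A → A
iter f zero    x = x
iter f (suc t) x = f (iter f t x)

Cell : ℕ → Set
Cell n = Fin n × Fin n

-- (0-based) diagonal index of cell (i , j):  (j - i) mod n.
-- The cell lies on D_s (s ∈ {1..n}) iff  s - 1 ≡ diagIndex.
diagIndex : (n : ℕ) .{{_ : NonZero n}} → Cell n → ℕ
diagIndex n (i , j) = (toℕ j + (n ∸ toℕ i)) % n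

-- Shape of a cyclically k-diagonal array whose first diagonal is D_r,
-- where r₀ : Fin n stands for r - 1 (r ∈ {1..n}).  A cell is nonempty iff
-- its diagonal D_s has s ∈ {r, …, r+k-1} (mod n), i.e. (s - r) mod n < k.
Filled : (n : ℕ) .{{_ : NonZero n}} (k : ℕ) (r₀ : Fin n) → Cell n → Set
Filled n k r₀ c = (diagIndex n c + (n ∸ toℕ r₀)) % n < k

-- The nonempty cells.  Since the entries are pairwise distinct, entries are
-- identified with the nonempty cells holding them.
Entry : (n : ℕ) .{{_ : NonZero n}} (k : ℕ) (r₀ : Fin n) → Set
Entry n k r₀ = Σ[ c ∈ Cell n ] Filled n k r₀ c

row : ∀ {n} .{{_ : NonZero n}} {k r₀} → Entry n k r₀ → Fin n
row ((i , j) , _) = i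

col : ∀ {n} .{{_ : NonZero n}} {k r₀} → Entry n k r₀ → Fin n
col ((i , j) , _) = j

-- An ordering of the lines given by `line` (rows or columns): a permutation
-- of the set of entries which is the product of disjoint cycles, one per
-- line, each cycle running through all the entries of its line.
record LineOrdering {n} .{{_ : NonZero n}} {k r₀}
                    (line : Entry n k r₀ → Fin n) : Set where
  field
    perm      : Entry n k r₀ ↔ Entry n k r₀
    preserves : ∀ e → line (Inverse.to perm e) ≡ line e
    cyclic    : ∀ e e' → line e ≡ line e' →
                ∃[ t ] iter (Inverse.to perm) t e ≡ e'

RowOrdering : (n : ℕ) .{{_ : NonZero n}} (k : ℕ) (r₀ : Fin n) → Set
RowOrdering n k r₀ = LineOrdering {n} {k} {r₀} (row {n} {k} {r₀})

ColumnOrdering : (n : ℕ) .{{_ : NonZero n}} (k : ℕ) (r₀ : Fin n) → Set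
ColumnOrdering n k r₀ = LineOrdering {n} {k} {r₀} (col {n} {k} {r₀})

-- A permutation of a finite set is a single cycle of length N (= size of
-- the set) iff the cyclic group it generates acts transitively.
IsSingleCycle : ∀ {a} {A : Set a} → (A → A) → Set a
IsSingleCycle {A = A} f = ∀ (x y : A) → ∃[ t ] iter f t x ≡ y

Compatible : ∀ {n} .{{_ : NonZero n}} {k r₀} →
             RowOrdering n k r₀ → ColumnOrdering n k r₀ → Set
Compatible ωr ωc =
  IsSingleCycle (λ e → Inverse.to (LineOrdering.perm ωr)
                         (Inverse.to (LineOrdering.perm ωc) e))

-- Describe an entry by its row i ∈ {0, …, n − 1} and its offset d ∈ {0, …, 6}, meaning that it
-- lies on the diagonal D_(r+d).  Order every column by d ↦ d + 1, and row i by d ↦ d + 1 if i is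
-- even and by the 7-cycle (0 1 5 4 2 3 6) if i is odd.  The column step then moves from row i to
-- row i − 1 (if d < 6) or to row i + 6 (if d = 6), so ω_r ∘ ω_c becomes an explicit map on
-- (row, offset) governed by the parities of the rows.  Away from the first and last rows, the
-- entries at offset 6 in rows j and j + 1 are six steps apart, the entries at offset 0 in even rows
-- and at offset 5 in odd rows descend to the entry (0, 0), and every other entry reaches offset 6
-- within five steps.  The finitely many paths crossing the boundary rows depend on n = 7 + u only
-- through u, whose evenness fixes the parities of the last rows; following them shows that every
-- entry reaches (0, 0), and an injective map with this property is a single cycle.

module Submission where

open import Defs
open import Data.Nat using (ℕ; _≤_; NonZero)
open import Data.Nat.Divisibility using (_∣_)
open import Data.Fin using (Fin)
open import Data.Product using (Σ; Σ-syntax; ∃; ∃-syntax)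
open import Relation.Nullary using (¬_)

open import Data.Empty using (⊥-elim)
open import Data.Unit using (tt)
open import Data.Nat using (zero; suc; _+_; _*_; _∸_; _<_; _≤?_; s≤s; s≤s⁻¹; parity)
open import Data.Nat.Properties
  using (+-suc; +-comm; +-assoc; +-identityʳ; *-suc; ≤-refl; ≤-trans; <⇒≤; ≰⇒>;
         m≤m+n; m≤n+m; +-monoʳ-≤; +-cancelʳ-≤; m+n∸n≡m; m∸n+n≡m; m+[n∸m]≡n;
         m≤n⇒∃[o]m+o≡n; <-irrelevant; n≮n; ≤-<-trans)
open import Data.Nat.DivMod using (_%_; m%n<n; m<n⇒m%n≡m; [m+n]%n≡m%n; %-distribˡ-+; m%n%n≡m%n)
open import Data.Nat.Divisibility using (divides)
open import Data.Nat.Tactic.RingSolver using (solve-∀)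
open import Data.Parity.Base as ℙ using (Parity; 0ℙ; 1ℙ; _⁻¹)
import Data.Parity.Properties as ℙ
open import Data.Fin using (zero; suc; toℕ; fromℕ<)
open import Data.Fin.Patterns using (0F; 1F; 2F; 3F; 4F; 5F; 6F)
open import Data.Fin.Properties using (toℕ-injective; toℕ<n; toℕ-fromℕ<; all?; any?; _≟_)
open import Data.Product using (_×_; _,_; proj₁; proj₂; map)
open import Function.Base using (id)
open import Function.Bundles using (_↔_; Inverse; Injection; mk↔ₛ′)
open import Function.Definitions using (Injective)
open import Function.Properties.Inverse using (↔-trans; ↔-sym; ↔⇒↣)
open import Relation.Binary.PropositionalEquality
open import Relation.Nullary using (yes; no; contradiction)
open import Relation.Nullary.Decidable using (True; toWitness)

↔-injective : ∀ {a b} {A : Set a} {B : Set b} (φ : A ↔ B) → Injective _≡_ _≡_ (Inverse.to φ)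
↔-injective φ = Injection.injective (↔⇒↣ φ)

Reaches : ∀ {a} {A : Set a} → (A → A) → A → A → Set a
Reaches f x y = ∃[ t ] iter f t x ≡ y

module _ {a} {A : Set a} {f : A → A} where

  iter-+ : ∀ s t x → iter f (s + t) x ≡ iter f s (iter f t x)
  iter-+ zero    t x = refl
  iter-+ (suc s) t x = cong f (iter-+ s t x)

  iter-commute : ∀ t x → iter f t (f x) ≡ f (iter f t x)
  iter-commute zero    x = refl
  iter-commute (suc t) x = cong f (iter-commute t x)

  infixr 5 _⟫_
  _⟫_ : ∀ {x y z} → Reaches f x y → Reaches f y z → Reaches f x z
  (s , fˢx≡y) ⟫ (t , fᵗy≡z) = t + s , trans (iter-+ t s _) (trans (cong (iter f t) fˢx≡y) fᵗy≡z)

  iter-injective : Injective _≡_ _≡_ f → ∀ t → Injective _≡_ _≡_ (iter f t)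
  iter-injective f-inj zero    eq = eq
  iter-injective f-inj (suc t) eq = iter-injective f-inj t (f-inj eq)

  iter-periodic : ∀ {P x} → iter f P x ≡ x → ∀ m → iter f (m * P) x ≡ x
  iter-periodic fᴾx≡x zero    = refl
  iter-periodic {P} {x} fᴾx≡x (suc m) =
    trans (iter-+ P (m * P) x) (trans (cong (iter f P) (iter-periodic fᴾx≡x m)) fᴾx≡x)

  periodic-↔ : ∀ m → (∀ x → iter f (suc m) x ≡ x) → A ↔ A
  periodic-↔ m period = mk↔ₛ′ f (iter f m) period (λ x → trans (iter-commute m x) (period x))

  -- b has period 1 + t₀, so if fᵗ y = b then fᵗ (f^(t t₀) b) = f^(t (1 + t₀)) b = fᵗ y,
  -- and f^(t t₀) b = y by injectivity.
  hub⇒single-cycle : Injective _≡_ _≡_ f → (b : A) → (∀ x → Reaches f x b) → IsSingleCycle f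
  hub⇒single-cycle f-inj b to-b x y = to-b x ⟫ from-b y
    where
    t₀ : ℕ
    t₀ = proj₁ (to-b (f b))

    b-periodic : iter f (suc t₀) b ≡ b
    b-periodic = trans (sym (iter-commute t₀ b)) (proj₂ (to-b (f b)))

    from-b : ∀ y → Reaches f b y
    from-b y with to-b y
    ... | t , fᵗy≡b = t * t₀ , iter-injective f-inj t (begin
      iter f t (iter f (t * t₀) b) ≡⟨ iter-+ t (t * t₀) b ⟨
      iter f (t + t * t₀) b        ≡⟨ cong (λ m → iter f m b) (*-suc t t₀) ⟨
      iter f (t * suc t₀) b        ≡⟨ iter-periodic b-periodic t ⟩
      b                            ≡⟨ fᵗy≡b ⟨
      iter f t y                   ∎)
      where open ≡-Reasoning

-- Cyclic orderings of seven offsets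

rotate : Fin 7 → Fin 7
rotate 0F = 1F
rotate 1F = 2F
rotate 2F = 3F
rotate 3F = 4F
rotate 4F = 5F
rotate 5F = 6F
rotate 6F = 0F

twist : Fin 7 → Fin 7
twist 0F = 1F
twist 1F = 5F
twist 2F = 3F
twist 3F = 6F
twist 4F = 2F
twist 5F = 4F
twist 6F = 0F

offsetCycle : Parity → Fin 7 → Fin 7
offsetCycle 0ℙ = rotate
offsetCycle 1ℙ = twist

returns-to-0F : (f : Fin 7 → Fin 7) →
                True (all? λ d → any? λ (t : Fin 7) → iter f (toℕ t) d ≟ 0F) →
                ∀ d → Reaches f d 0F
returns-to-0F f check d = map toℕ id (toWitness check d)

offsetCycle-order : ∀ p d → iter (offsetCycle p) 7 d ≡ d
offsetCycle-order 0ℙ = toWitness {a? = all? λ d → iter rotate 7 d ≟ d} tt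
offsetCycle-order 1ℙ = toWitness {a? = all? λ d → iter twist 7 d ≟ d} tt

offsetCycle-returns : ∀ p d → Reaches (offsetCycle p) d 0F
offsetCycle-returns 0ℙ = returns-to-0F rotate tt
offsetCycle-returns 1ℙ = returns-to-0F twist tt

offsetCycle-↔ : Parity → Fin 7 ↔ Fin 7
offsetCycle-↔ p = periodic-↔ {f = offsetCycle p} 6 (offsetCycle-order p)

offsetCycle-single-cycle : ∀ p → IsSingleCycle (offsetCycle p)
offsetCycle-single-cycle p =
  hub⇒single-cycle {f = offsetCycle p} (↔-injective (offsetCycle-↔ p)) 0F (offsetCycle-returns p)

module Modular (n : ℕ) .{{_ : NonZero n}} where

  infixl 6 _⊖_
  _⊖_ : ℕ → ℕ → ℕ
  x ⊖ y = (x + (n ∸ y)) % n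

  ⊖-< : ∀ x y → x ⊖ y < n
  ⊖-< x y = m%n<n (x + (n ∸ y)) n

  [a%n+b]%n≡[a+b]%n : ∀ a b → (a % n + b) % n ≡ (a + b) % n
  [a%n+b]%n≡[a+b]%n a b = begin
    (a % n + b) % n         ≡⟨ %-distribˡ-+ (a % n) b n ⟩
    (a % n % n + b % n) % n ≡⟨ cong (λ x → (x + b % n) % n) (m%n%n≡m%n a n) ⟩
    (a % n + b % n) % n     ≡⟨ %-distribˡ-+ a b n ⟨
    (a + b) % n             ∎
    where open ≡-Reasoning

  [a+b%n]%n≡[a+b]%n : ∀ a b → (a + b % n) % n ≡ (a + b) % n
  [a+b%n]%n≡[a+b]%n a b = begin
    (a + b % n) % n ≡⟨ cong (_% n) (+-comm a (b % n)) ⟩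
    (b % n + a) % n ≡⟨ [a%n+b]%n≡[a+b]%n b a ⟩
    (b + a) % n     ≡⟨ cong (_% n) (+-comm b a) ⟩
    (a + b) % n     ∎
    where open ≡-Reasoning

  [x+n]%n≡x : ∀ {x} → x < n → (x + n) % n ≡ x
  [x+n]%n≡x {x} x<n = trans ([m+n]%n≡m%n x n) (m<n⇒m%n≡m x<n)

  +-⊖-cancelˡ : ∀ {y z} → y < n → z < n → (y + z) % n ⊖ y ≡ z
  +-⊖-cancelˡ {y} {z} y<n z<n = begin
    ((y + z) % n + (n ∸ y)) % n ≡⟨ [a%n+b]%n≡[a+b]%n (y + z) (n ∸ y) ⟩
    (y + z + (n ∸ y)) % n       ≡⟨ cong (λ x → (x + (n ∸ y)) % n) (+-comm y z) ⟩
    (z + y + (n ∸ y)) % n       ≡⟨ cong (_% n) (+-assoc z y (n ∸ y)) ⟩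
    (z + (y + (n ∸ y))) % n     ≡⟨ cong (λ x → (z + x) % n) (m+[n∸m]≡n (<⇒≤ y<n)) ⟩
    (z + n) % n                 ≡⟨ [x+n]%n≡x z<n ⟩
    z                           ∎
    where open ≡-Reasoning

  +-⊖-cancelʳ : ∀ {x y} → x < n → y < n → (x + y) % n ⊖ y ≡ x
  +-⊖-cancelʳ {x} {y} x<n y<n =
    trans (cong (λ s → s % n ⊖ y) (+-comm x y)) (+-⊖-cancelˡ y<n x<n)

  ⊖-+-cancel : ∀ {x y} → x < n → y < n → (y + (x ⊖ y)) % n ≡ x
  ⊖-+-cancel {x} {y} x<n y<n = begin
    (y + (x + (n ∸ y)) % n) % n ≡⟨ [a+b%n]%n≡[a+b]%n y (x + (n ∸ y)) ⟩
    (y + (x + (n ∸ y))) % n     ≡⟨ cong (_% n) (+-assoc y x (n ∸ y)) ⟨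
    (y + x + (n ∸ y)) % n       ≡⟨ cong (λ s → (s + (n ∸ y)) % n) (+-comm y x) ⟩
    (x + y + (n ∸ y)) % n       ≡⟨ cong (_% n) (+-assoc x y (n ∸ y)) ⟩
    (x + (y + (n ∸ y))) % n     ≡⟨ cong (λ s → (x + s) % n) (m+[n∸m]≡n (<⇒≤ y<n)) ⟩
    (x + n) % n                 ≡⟨ [x+n]%n≡x x<n ⟩
    x                           ∎
    where open ≡-Reasoning

  ⊖-⊖-cancel : ∀ {x c} → x < n → c < n → x ⊖ (x ⊖ c) ≡ c
  ⊖-⊖-cancel {x} {c} x<n c<n =
    trans (cong (_⊖ (x ⊖ c)) (sym (⊖-+-cancel x<n c<n))) (+-⊖-cancelʳ c<n (⊖-< x c))

  +-%-cancelʳ : ∀ {c x y} → c < n → x < n → y < n → (x + c) % n ≡ (y + c) % n → x ≡ y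
  +-%-cancelʳ {c} {x} {y} c<n x<n y<n eq = begin
    x             ≡⟨ +-⊖-cancelʳ x<n c<n ⟨
    (x + c) % n ⊖ c ≡⟨ cong (_⊖ c) eq ⟩
    (y + c) % n ⊖ c ≡⟨ +-⊖-cancelʳ y<n c<n ⟩
    y             ∎
    where open ≡-Reasoning

-- An entry on the diagonal D_(r+d) has offset d; it is determined by its row
-- (or its column) and its offset.
module Coordinates (n : ℕ) .{{_ : NonZero n}} (k : ℕ) (k≤n : k ≤ n) (r₀ : Fin n) where
  open Modular n

  r : ℕ
  r = toℕ r₀

  rowOf colOf : Entry n k r₀ → Fin n
  rowOf = row {n} {k} {r₀}
  colOf = col {n} {k} {r₀}

  entry-≡ : {e e' : Entry n k r₀} → proj₁ e ≡ proj₁ e' → e ≡ e'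
  entry-≡ {c , f} {.c , f'} refl = cong (c ,_) (<-irrelevant f f')

  offset : Entry n k r₀ → Fin k
  offset (_ , filled) = fromℕ< filled

  shift : Fin k → ℕ
  shift d = (r + toℕ d) % n

  shift-< : ∀ d → shift d < n
  shift-< d = m%n<n (r + toℕ d) n

  shift-⊖ : ∀ d → shift d ⊖ r ≡ toℕ d
  shift-⊖ d = +-⊖-cancelˡ (toℕ<n r₀) (≤-trans (toℕ<n d) k≤n)

  column-equation : (e : Entry n k r₀) → toℕ (colOf e) ≡ (toℕ (rowOf e) + shift (offset e)) % n
  column-equation ((i , j) , filled) = sym (begin
    (toℕ i + (r + toℕ (fromℕ< filled)) % n) % n
      ≡⟨ cong (λ d → (toℕ i + (r + d) % n) % n) (toℕ-fromℕ< filled) ⟩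
    (toℕ i + (r + (toℕ j ⊖ toℕ i ⊖ r)) % n) % n
      ≡⟨ cong (λ s → (toℕ i + s) % n) (⊖-+-cancel (⊖-< (toℕ j) (toℕ i)) (toℕ<n r₀)) ⟩
    (toℕ i + (toℕ j ⊖ toℕ i)) % n
      ≡⟨ ⊖-+-cancel (toℕ<n j) (toℕ<n i) ⟩
    toℕ j ∎)
    where open ≡-Reasoning

  row-equation : (e : Entry n k r₀) → toℕ (rowOf e) ≡ toℕ (colOf e) ⊖ shift (offset e)
  row-equation e = begin
    toℕ (rowOf e)                    ≡⟨ +-⊖-cancelʳ (toℕ<n (rowOf e)) (shift-< (offset e)) ⟨
    (toℕ (rowOf e) + s) % n ⊖ s      ≡⟨ cong (_⊖ s) (column-equation e) ⟨
    toℕ (colOf e) ⊖ s                ∎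
    where
    open ≡-Reasoning
    s = shift (offset e)

  coordinates : (line : Entry n k r₀ → Fin n) (entry-at : Fin n → Fin k → Entry n k r₀) →
                (∀ a d → line (entry-at a d) ≡ a) → (∀ a d → offset (entry-at a d) ≡ d) →
                (∀ e → entry-at (line e) (offset e) ≡ e) →
                Entry n k r₀ ↔ (Fin n × Fin k)
  coordinates line entry-at line-at offset-at at-coordinates =
    mk↔ₛ′ (λ e → line e , offset e) (λ (a , d) → entry-at a d)
          (λ (a , d) → cong₂ _,_ (line-at a d) (offset-at a d)) at-coordinates

  column-in-row : Fin n → Fin k → Fin n
  column-in-row i d = fromℕ< (m%n<n (toℕ i + shift d) n)

  column-in-row-offset : ∀ i d → toℕ (column-in-row i d) ⊖ toℕ i ⊖ r ≡ toℕ d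
  column-in-row-offset i d = begin
    toℕ (column-in-row i d) ⊖ toℕ i ⊖ r
      ≡⟨ cong (λ j → j ⊖ toℕ i ⊖ r) (toℕ-fromℕ< (m%n<n (toℕ i + shift d) n)) ⟩
    (toℕ i + shift d) % n ⊖ toℕ i ⊖ r   ≡⟨ cong (_⊖ r) (+-⊖-cancelˡ (toℕ<n i) (shift-< d)) ⟩
    shift d ⊖ r                         ≡⟨ shift-⊖ d ⟩
    toℕ d                               ∎
    where open ≡-Reasoning

  row-in-column : Fin n → Fin k → Fin n
  row-in-column j d = fromℕ< (⊖-< (toℕ j) (shift d))

  row-in-column-offset : ∀ j d → toℕ j ⊖ toℕ (row-in-column j d) ⊖ r ≡ toℕ d
  row-in-column-offset j d = begin
    toℕ j ⊖ toℕ (row-in-column j d) ⊖ r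
      ≡⟨ cong (λ i → toℕ j ⊖ i ⊖ r) (toℕ-fromℕ< (⊖-< (toℕ j) (shift d))) ⟩
    toℕ j ⊖ (toℕ j ⊖ shift d) ⊖ r       ≡⟨ cong (_⊖ r) (⊖-⊖-cancel (toℕ<n j) (shift-< d)) ⟩
    shift d ⊖ r                         ≡⟨ shift-⊖ d ⟩
    toℕ d                               ∎
    where open ≡-Reasoning

  entry-in-row : Fin n → Fin k → Entry n k r₀
  entry-in-row i d = (i , column-in-row i d) , subst (_< k) (sym (column-in-row-offset i d)) (toℕ<n d)

  entry-in-column : Fin n → Fin k → Entry n k r₀
  entry-in-column j d = (row-in-column j d , j) , subst (_< k) (sym (row-in-column-offset j d)) (toℕ<n d)

  rowCoords : Entry n k r₀ ↔ (Fin n × Fin k)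
  rowCoords = coordinates rowOf entry-in-row (λ _ _ → refl)
    (λ i d → toℕ-injective (trans (toℕ-fromℕ< _) (column-in-row-offset i d)))
    (λ e → entry-≡ (cong (rowOf e ,_) (toℕ-injective (trans (toℕ-fromℕ< _) (sym (column-equation e))))))

  colCoords : Entry n k r₀ ↔ (Fin n × Fin k)
  colCoords = coordinates colOf entry-in-column (λ _ _ → refl)
    (λ j d → toℕ-injective (trans (toℕ-fromℕ< _) (row-in-column-offset j d)))
    (λ e → entry-≡ (cong (_, colOf e) (toℕ-injective (trans (toℕ-fromℕ< _) (sym (row-equation e))))))

-- Line orderings from cyclic orderings of the fibres

module Fibrewise {n} .{{_ : NonZero n}} {k r₀} {line : Entry n k r₀ → Fin n}
                 (φ : Entry n k r₀ ↔ (Fin n × Fin k))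
                 (φ-line : ∀ e → proj₁ (Inverse.to φ e) ≡ line e)
                 (σ : Fin n → Fin k ↔ Fin k)
                 (σ-cyclic : ∀ a → IsSingleCycle (Inverse.to (σ a))) where

  open Inverse

  inFibre : Fin n × Fin k → Fin n × Fin k
  inFibre (a , d) = a , to (σ a) d

  fibres : (Fin n × Fin k) ↔ (Fin n × Fin k)
  fibres = mk↔ₛ′ inFibre (λ (a , d) → a , from (σ a) d)
    (λ (a , d) → cong (a ,_) (strictlyInverseˡ (σ a) d))
    (λ (a , d) → cong (a ,_) (strictlyInverseʳ (σ a) d))

  permutation : Entry n k r₀ ↔ Entry n k r₀
  permutation = ↔-trans φ (↔-trans fibres (↔-sym φ))

  coordinates-step : ∀ e → to φ (to permutation e) ≡ inFibre (to φ e)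
  coordinates-step e = strictlyInverseˡ φ (inFibre (to φ e))

  coordinates-iter : ∀ t e → to φ (iter (to permutation) t e)
                           ≡ (proj₁ (to φ e) , iter (to (σ (proj₁ (to φ e)))) t (proj₂ (to φ e)))
  coordinates-iter zero    e = refl
  coordinates-iter (suc t) e = trans (coordinates-step _) (cong inFibre (coordinates-iter t e))

  ordering : LineOrdering {n} {k} {r₀} line
  ordering = record
    { perm      = permutation
    ; preserves = λ e → trans (sym (φ-line _)) (trans (cong proj₁ (coordinates-step e)) (φ-line e))
    ; cyclic    = cyclic
    }
    where
    cyclic : ∀ e e' → line e ≡ line e' → ∃[ t ] iter (to permutation) t e ≡ e'
    cyclic e e' same-line with σ-cyclic (proj₁ (to φ e)) (proj₂ (to φ e)) (proj₂ (to φ e'))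
    ... | t , σᵗd≡d' = t , ↔-injective φ (begin
      to φ (iter (to permutation) t e)  ≡⟨ coordinates-iter t e ⟩
      (proj₁ (to φ e) , _)              ≡⟨ cong₂ _,_ same-fibre σᵗd≡d' ⟩
      to φ e'                           ∎)
      where
      open ≡-Reasoning
      same-fibre = trans (φ-line e) (trans same-line (sym (φ-line e')))

parity-suc : ∀ m → parity (suc m) ≡ parity m ⁻¹
parity-suc m = trans (sym (ℙ.⁻¹-involutive _)) (cong _⁻¹ (ℙ.suc-homo-⁻¹ m))

parity-residue : ∀ k j p → p ≡ parity (k + j) → parity j ≡ parity k ℙ.+ p
parity-residue k j p p≡ = begin
  parity j                              ≡⟨ ℙ.+-identityˡ (parity j) ⟨
  0ℙ ℙ.+ parity j                       ≡⟨ cong (ℙ._+ parity j) (ℙ.p+p≡0ℙ (parity k)) ⟨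
  parity k ℙ.+ parity k ℙ.+ parity j    ≡⟨ ℙ.+-assoc (parity k) (parity k) (parity j) ⟩
  parity k ℙ.+ (parity k ℙ.+ parity j)  ≡⟨ cong (parity k ℙ.+_) (trans (sym (ℙ.+-homo-+ k j)) (sym p≡)) ⟩
  parity k ℙ.+ p                        ∎
  where open ≡-Reasoning

parity≡0ℙ⇒2∣ : ∀ m → parity m ≡ 0ℙ → 2 ∣ m
parity≡0ℙ⇒2∣ zero          _  = divides 0 refl
parity≡0ℙ⇒2∣ (suc (suc m)) eq with parity≡0ℙ⇒2∣ m eq
... | divides q m≡q*2 = divides (suc q) (cong (λ x → suc (suc x)) m≡q*2)

-- The orbit model

module Orbit (u : ℕ) (u-even : parity u ≡ 0ℙ) where

  n T : ℕ
  n = 7 + u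
  T = 6 + u

  -- (row, parity of the row, offset); carrying the parity lets steps compute
  -- on rows such as 3 + u.
  State : Set
  State = ℕ × Parity × Fin 7

  -- T is even since n is odd
  descend : ℕ → Parity → ℕ × Parity
  descend zero    p = T , 0ℙ
  descend (suc i) p = i , p ⁻¹

  climb : ℕ → Parity → ℕ × Parity
  climb i p with i ≤? u
  ... | yes _ = 6 + i , p
  ... | no  _ = i ∸ suc u , p ⁻¹

  columnStep : ℕ → Parity → Fin 7 → ℕ × Parity
  columnStep i p 6F = climb i p
  columnStep i p _  = descend i p

  rowStep : ℕ × Parity → Fin 7 → State
  rowStep (i , p) d = i , p , offsetCycle p d

  step : State → State
  step (i , p , d) = rowStep (columnStep i p d) (rotate d)

  infix 4 _↝_
  _↝_ : State → State → Set
  _↝_ = Reaches step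

  b₀ : State
  b₀ = 0 , 0ℙ , 0F

  data Height : ℕ → Set where
    low  : ∀ {i} → i ≤ u → Height i
    high : ∀ a → Height (suc a + u)

  height : ∀ i → Height i
  height i with i ≤? u
  ... | yes i≤u = low i≤u
  ... | no  i≰u = subst Height (trans (sym (+-suc _ u)) (m∸n+n≡m (≰⇒> i≰u))) (high (i ∸ suc u))

  climb-low : ∀ {i p} → i ≤ u → climb i p ≡ (6 + i , p)
  climb-low {i} i≤u with i ≤? u
  ... | yes _   = refl
  ... | no  i≰u = contradiction i≤u i≰u

  climb-high : ∀ a p → climb (suc a + u) p ≡ (a , p ⁻¹)
  climb-high a p with suc a + u ≤? u
  ... | yes a+u<u = contradiction (≤-trans (s≤s (m≤n+m u a)) a+u<u) (n≮n u)
  ... | no  _     = cong (_, p ⁻¹) (m+n∸n≡m a u)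

  parity-+u : ∀ m → parity (m + u) ≡ parity m
  parity-+u m = trans (ℙ.+-homo-+ m u) (trans (cong (parity m ℙ.+_) u-even) (ℙ.+-identityʳ (parity m)))

  ladder : ∀ i → parity i ≡ 0ℙ → (i , 0ℙ , 0F) ↝ b₀
  ladder zero          _      = 0 , refl
  ladder (suc (suc i)) i-even = (2 , refl) ⟫ ladder i i-even

  rise : ∀ j p → j ≤ u → (j , p , 6F) ↝ (6 + j , p , offsetCycle p 0F)
  rise j p j≤u = 1 , cong (λ s → rowStep s 0F) (climb-low j≤u)

  wrap : ∀ a p → (suc a + u , p , 6F) ↝ (a , p ⁻¹ , offsetCycle (p ⁻¹) 0F)
  wrap a p = 1 , cong (λ s → rowStep s 0F) (climb-high a p)

  data Track : Parity → Fin 7 → ℕ → Set where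
    even-1 : Track 0ℙ 1F 5
    odd-3  : Track 1ℙ 3F 4
    even-5 : Track 0ℙ 5F 3
    odd-0  : Track 1ℙ 0F 2
    even-2 : Track 0ℙ 2F 1
    odd-1  : Track 1ℙ 1F 5
    even-3 : Track 0ℙ 3F 4
    odd-2  : Track 1ℙ 2F 3
    even-4 : Track 0ℙ 4F 2
    odd-4  : Track 1ℙ 4F 1

  along-track : ∀ {p d k} → Track p d k → ∀ j → (k + j , p , d) ↝ (j , parity k ℙ.+ p , 6F)
  along-track even-1 j = 5 , refl
  along-track odd-3  j = 4 , refl
  along-track even-5 j = 3 , refl
  along-track odd-0  j = 2 , refl
  along-track even-2 j = 1 , refl
  along-track odd-1  j = 5 , refl
  along-track even-3 j = 4 , refl
  along-track odd-2  j = 3 , refl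
  along-track even-4 j = 2 , refl
  along-track odd-4  j = 1 , refl

  rung-up : ∀ j p → j ≤ u → (j , p , 6F) ↝ (suc j , p ⁻¹ , 6F)
  rung-up j 0ℙ j≤u = rise j 0ℙ j≤u ⟫ along-track even-1 (suc j)
  rung-up j 1ℙ j≤u = rise j 1ℙ j≤u ⟫ along-track odd-1 (suc j)

  climb-to-summit : ∀ g j p → g + j ≡ u → p ≡ parity j → (j , p , 6F) ↝ (suc u , 1ℙ , 6F)
  climb-to-summit zero    j p refl p≡ with trans p≡ u-even
  ... | refl = rung-up u 0ℙ ≤-refl
  climb-to-summit (suc g) j p g+j≡u p≡ =
    rung-up j p (subst (j ≤_) g+j≡u (m≤n+m j (suc g)))
    ⟫ climb-to-summit g (suc j) (p ⁻¹) (trans (+-suc g j) g+j≡u) (trans (cong _⁻¹ p≡) (sym (parity-suc j)))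

  -- The rungs in the last six rows, each left by wrapping around: the orbit visits them in the
  -- order T − 1, T − 2, T, (rows 0, …, u + 1,) T − 5, T − 4, T − 3 and then joins the ladder at T.
  from-T-3 : (3 + u , 1ℙ , 6F) ↝ b₀
  from-T-3 = wrap 2 1ℙ ⟫ (3 , refl) ⟫ ladder T u-even

  from-T-4 : (2 + u , 0ℙ , 6F) ↝ b₀
  from-T-4 = wrap 1 0ℙ ⟫ (5 , refl) ⟫ from-T-3

  from-T-5 : (1 + u , 1ℙ , 6F) ↝ b₀
  from-T-5 = wrap 0 1ℙ ⟫ (5 , refl) ⟫ from-T-4

  from-T : (6 + u , 0ℙ , 6F) ↝ b₀
  from-T = wrap 5 0ℙ ⟫ (5 , refl) ⟫ climb-to-summit u 0 0ℙ (+-identityʳ u) refl ⟫ from-T-5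

  from-T-2 : (4 + u , 0ℙ , 6F) ↝ b₀
  from-T-2 = wrap 3 0ℙ ⟫ (4 , refl) ⟫ from-T

  from-T-1 : (5 + u , 1ℙ , 6F) ↝ b₀
  from-T-1 = wrap 4 1ℙ ⟫ (7 , refl) ⟫ from-T-2

  from-high-rung : ∀ a → a < 6 → (suc a + u , parity (suc a) , 6F) ↝ b₀
  from-high-rung 0 _ = from-T-5
  from-high-rung 1 _ = from-T-4
  from-high-rung 2 _ = from-T-3
  from-high-rung 3 _ = from-T-2
  from-high-rung 4 _ = from-T-1
  from-high-rung 5 _ = from-T
  from-high-rung (suc (suc (suc (suc (suc (suc _)))))) (s≤s (s≤s (s≤s (s≤s (s≤s (s≤s ()))))))

  from-rung : ∀ j p → j < n → p ≡ parity j → (j , p , 6F) ↝ b₀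
  from-rung j p j<n p≡ with height j
  ... | low j≤u = climb-to-summit (u ∸ j) j p (m∸n+n≡m j≤u) p≡ ⟫ from-T-5
  ... | high a  = subst (λ q → (suc a + u , q , 6F) ↝ b₀) (sym (trans p≡ (parity-+u (suc a))))
                        (from-high-rung a (s≤s⁻¹ (+-cancelʳ-≤ u (suc (suc a)) 7 j<n)))

  -- These paths pass from row 0 to row T before reaching offset 6F.
  below-track : ∀ {p d k} → Track p d k → (i : Fin k) → p ≡ parity (toℕ i) → (toℕ i , p , d) ↝ b₀
  below-track even-1 0F refl = (5 , refl) ⟫ from-T-4
  below-track even-1 2F refl = (3 , refl) ⟫ ladder T u-even
  below-track even-1 4F refl = (7 , refl) ⟫ from-T-2
  below-track odd-3  1F refl = (2 , refl) ⟫ ladder T u-even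
  below-track odd-3  3F refl = (6 , refl) ⟫ from-T-2
  below-track even-5 0F refl = (1 , refl) ⟫ ladder T u-even
  below-track even-5 2F refl = (5 , refl) ⟫ from-T-2
  below-track odd-0  1F refl = (4 , refl) ⟫ from-T-2
  below-track even-2 0F refl = (3 , refl) ⟫ from-T-2
  below-track odd-1  1F refl = (5 , refl) ⟫ from-T-3
  below-track odd-1  3F refl = (4 , refl) ⟫ from-T
  below-track even-3 0F refl = (4 , refl) ⟫ from-T-3
  below-track even-3 2F refl = (3 , refl) ⟫ from-T
  below-track odd-2  1F refl = (2 , refl) ⟫ from-T
  below-track even-4 0F refl = (1 , refl) ⟫ from-T
  below-track even-1 (suc (suc (suc (suc (suc ()))))) _
  below-track odd-1  (suc (suc (suc (suc (suc ()))))) _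

  from-track : ∀ {p d k} → Track p d k → ∀ i → i < n → p ≡ parity i → (i , p , d) ↝ b₀
  from-track {p} {d} {k} track i i<n p≡ with k ≤? i
  ... | no k≰i = subst (λ x → (x , p , d) ↝ b₀) (toℕ-fromℕ< i<k)
                   (below-track track (fromℕ< i<k) (trans p≡ (cong parity (sym (toℕ-fromℕ< i<k)))))
    where
    i<k : i < k
    i<k = ≰⇒> k≰i
  ... | yes k≤i with m≤n⇒∃[o]m+o≡n k≤i
  ...   | j , refl = along-track track j
                     ⟫ from-rung j _ (≤-<-trans (m≤n+m j k) i<n) (sym (parity-residue k j p p≡))

  reaches-b₀ : ∀ i p d → i < n → p ≡ parity i → (i , p , d) ↝ b₀
  reaches-b₀ i       0ℙ 0F _   p≡ = ladder i (sym p≡)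
  reaches-b₀ (suc i) 1ℙ 5F _   p≡ = (1 , refl) ⟫ ladder i (sym (trans (cong _⁻¹ p≡) (ℙ.suc-homo-⁻¹ i)))
  reaches-b₀ i       p  6F i<n p≡ = from-rung i p i<n p≡
  reaches-b₀ i       0ℙ 1F i<n p≡ = from-track even-1 i i<n p≡
  reaches-b₀ i       1ℙ 3F i<n p≡ = from-track odd-3  i i<n p≡
  reaches-b₀ i       0ℙ 5F i<n p≡ = from-track even-5 i i<n p≡
  reaches-b₀ i       1ℙ 0F i<n p≡ = from-track odd-0  i i<n p≡
  reaches-b₀ i       0ℙ 2F i<n p≡ = from-track even-2 i i<n p≡
  reaches-b₀ i       1ℙ 1F i<n p≡ = from-track odd-1  i i<n p≡
  reaches-b₀ i       0ℙ 3F i<n p≡ = from-track even-3 i i<n p≡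
  reaches-b₀ i       1ℙ 2F i<n p≡ = from-track odd-2  i i<n p≡
  reaches-b₀ i       0ℙ 4F i<n p≡ = from-track even-4 i i<n p≡
  reaches-b₀ i       1ℙ 4F i<n p≡ = from-track odd-4  i i<n p≡

  data ColumnMove (i : ℕ) (p : Parity) : Fin 7 → Set where
    descends : ∀ {d} → columnStep i p d ≡ descend i p → toℕ (rotate d) ≡ suc (toℕ d) → ColumnMove i p d
    climbs   : ColumnMove i p 6F

  column-move : ∀ i p d → ColumnMove i p d
  column-move i p 0F = descends refl refl
  column-move i p 1F = descends refl refl
  column-move i p 2F = descends refl refl
  column-move i p 3F = descends refl refl
  column-move i p 4F = descends refl refl
  column-move i p 5F = descends refl refl
  column-move i p 6F = climbs

  descend-< : ∀ i p → i < n → proj₁ (descend i p) < n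
  descend-< zero    p _   = ≤-refl
  descend-< (suc i) p i<n = <⇒≤ i<n

  climb-< : ∀ i p → i < n → proj₁ (climb i p) < n
  climb-< i p i<n with height i
  ... | low i≤u rewrite climb-low {p = p} i≤u = s≤s (+-monoʳ-≤ 6 i≤u)
  ... | high a  rewrite climb-high a p       = ≤-trans (s≤s (m≤m+n a u)) (<⇒≤ i<n)

  columnStep-< : ∀ i p d → i < n → proj₁ (columnStep i p d) < n
  columnStep-< i p d i<n with column-move i p d
  ... | descends eq _ rewrite eq = descend-< i p i<n
  ... | climbs                   = climb-< i p i<n

  descend-parity : ∀ i p → p ≡ parity i → proj₂ (descend i p) ≡ parity (proj₁ (descend i p))
  descend-parity zero    p _  = sym u-even
  descend-parity (suc i) p p≡ = trans (cong _⁻¹ p≡) (ℙ.suc-homo-⁻¹ i)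

  climb-parity : ∀ i p → p ≡ parity i → proj₂ (climb i p) ≡ parity (proj₁ (climb i p))
  climb-parity i p p≡ with height i
  ... | low i≤u rewrite climb-low {p = p} i≤u = p≡
  ... | high a  rewrite climb-high a p       = trans (cong _⁻¹ (trans p≡ (parity-+u (suc a)))) (ℙ.suc-homo-⁻¹ a)

  columnStep-parity : ∀ i p d → p ≡ parity i → proj₂ (columnStep i p d) ≡ parity (proj₁ (columnStep i p d))
  columnStep-parity i p d p≡ with column-move i p d
  ... | descends eq _ rewrite eq = descend-parity i p p≡
  ... | climbs                   = climb-parity i p p≡

  -- Row + offset is constant along a column, modulo n.
  descend-congruent : ∀ c i p m → (proj₁ (descend i p) + (c + suc m)) % n ≡ (i + (c + m)) % n
  descend-congruent c zero    p m = trans (cong (_% n) (wrap-around u c m)) ([m+n]%n≡m%n (c + m) n)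
    where
    wrap-around : ∀ u c m → 6 + u + (c + suc m) ≡ c + m + (7 + u)
    wrap-around = solve-∀
  descend-congruent c (suc i) p m = cong (_% n) (shift-one i c m)
    where
    shift-one : ∀ i c m → i + (c + suc m) ≡ suc i + (c + m)
    shift-one = solve-∀

  climb-congruent : ∀ c i p → (proj₁ (climb i p) + (c + 0)) % n ≡ (i + (c + 6)) % n
  climb-congruent c i p with height i
  ... | low i≤u rewrite climb-low {p = p} i≤u = cong (_% n) (shift-six i c)
    where
    shift-six : ∀ i c → 6 + i + (c + 0) ≡ i + (c + 6)
    shift-six = solve-∀
  ... | high a  rewrite climb-high a p =
    trans (sym ([m+n]%n≡m%n (a + (c + 0)) n)) (cong (_% n) (wrap-around a u c))
    where
    wrap-around : ∀ a u c → a + (c + 0) + (7 + u) ≡ suc a + u + (c + 6)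
    wrap-around = solve-∀

  columnStep-congruent : ∀ c i p d → (proj₁ (columnStep i p d) + (c + toℕ (rotate d))) % n ≡ (i + (c + toℕ d)) % n
  columnStep-congruent c i p d with column-move i p d
  ... | descends eq rot rewrite eq | rot = descend-congruent c i p (toℕ d)
  ... | climbs                          = climb-congruent c i p

-- The orderings, and ω_r ∘ ω_c in coordinates

module Construction (u : ℕ) (u-even : parity u ≡ 0ℙ) (r₀ : Fin (7 + u)) where
  open Orbit u u-even
  open Modular n
  open Coordinates n 7 (m≤m+n 7 u) r₀
  open Inverse using (to)

  module Rows = Fibrewise {n} {7} {r₀} {rowOf} rowCoords (λ _ → refl)
                  (λ i → offsetCycle-↔ (parity (toℕ i))) (λ i → offsetCycle-single-cycle (parity (toℕ i)))
  module Columns = Fibrewise {n} {7} {r₀} {colOf} colCoords (λ _ → refl)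
                     (λ _ → offsetCycle-↔ 0ℙ) (λ _ → offsetCycle-single-cycle 0ℙ)

  ωr : RowOrdering n 7 r₀
  ωr = Rows.ordering

  ωc : ColumnOrdering n 7 r₀
  ωc = Columns.ordering

  G : Entry n 7 r₀ → Entry n 7 r₀
  G e = to (LineOrdering.perm ωr) (to (LineOrdering.perm ωc) e)

  G-injective : Injective _≡_ _≡_ G
  G-injective eq = ↔-injective (LineOrdering.perm ωc) (↔-injective (LineOrdering.perm ωr) eq)

  toState : Fin n × Fin 7 → State
  toState (a , d) = toℕ a , parity (toℕ a) , d

  θ : Entry n 7 r₀ → State
  θ e = toState (to rowCoords e)

  θ-injective : Injective _≡_ _≡_ θ
  θ-injective eq = ↔-injective rowCoords
                     (cong₂ _,_ (toℕ-injective (cong proj₁ eq)) (cong (λ s → proj₂ (proj₂ s)) eq))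

  column-successor-offset : ∀ e → offset (to Columns.permutation e) ≡ rotate (offset e)
  column-successor-offset e = cong proj₂ (Columns.coordinates-step e)

  column-successor-row : ∀ e → let i = toℕ (rowOf e) in
    toℕ (rowOf (to Columns.permutation e)) ≡ proj₁ (columnStep i (parity i) (offset e))
  column-successor-row e =
    +-%-cancelʳ (shift-< d′) (toℕ<n (rowOf e′)) (columnStep-< i (parity i) d (toℕ<n (rowOf e))) (begin
    (toℕ (rowOf e′) + shift d′) % n  ≡⟨ column-equation e′ ⟨
    toℕ (colOf e′)                   ≡⟨ cong (λ x → toℕ (proj₁ x)) (Columns.coordinates-step e) ⟩
    toℕ (colOf e)                    ≡⟨ column-equation e ⟩
    (i + shift d) % n                ≡⟨ [a+b%n]%n≡[a+b]%n i (r + toℕ d) ⟩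
    (i + (r + toℕ d)) % n            ≡⟨ columnStep-congruent r i (parity i) d ⟨
    (w + (r + toℕ (rotate d))) % n   ≡⟨ [a+b%n]%n≡[a+b]%n w (r + toℕ (rotate d)) ⟨
    (w + shift (rotate d)) % n       ≡⟨ cong (λ x → (w + shift x) % n) (column-successor-offset e) ⟨
    (w + shift d′) % n               ∎)
    where
    open ≡-Reasoning
    e′ = to Columns.permutation e
    i = toℕ (rowOf e)
    d = offset e
    d′ = offset e′
    w = proj₁ (columnStep i (parity i) d)

  column-step-tracked : ∀ e → let i = toℕ (rowOf e); i′ = toℕ (rowOf (to Columns.permutation e)) in
    columnStep i (parity i) (offset e) ≡ (i′ , parity i′)
  column-step-tracked e = begin
    columnStep i (parity i) (offset e)  ≡⟨ cong (proj₁ s ,_) (columnStep-parity i (parity i) (offset e) refl) ⟩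
    (proj₁ s , parity (proj₁ s))        ≡⟨ cong (λ x → x , parity x) (column-successor-row e) ⟨
    (i′ , parity i′)                    ∎
    where
    open ≡-Reasoning
    i = toℕ (rowOf e)
    i′ = toℕ (rowOf (to Columns.permutation e))
    s = columnStep i (parity i) (offset e)

  θ-conjugates : ∀ e → θ (G e) ≡ step (θ e)
  θ-conjugates e = begin
    θ (G e)                         ≡⟨ cong toState (Rows.coordinates-step e′) ⟩
    rowStep (i′ , parity i′) (offset e′) ≡⟨ cong (rowStep (i′ , parity i′)) (column-successor-offset e) ⟩
    rowStep (i′ , parity i′) (rotate d)  ≡⟨ cong (λ s → rowStep s (rotate d)) (column-step-tracked e) ⟨
    step (θ e)                      ∎
    where
    open ≡-Reasoning
    e′ = to Columns.permutation e
    i′ = toℕ (rowOf e′)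
    d = offset e

  θ-iter : ∀ t e → θ (iter G t e) ≡ iter step t (θ e)
  θ-iter zero    e = refl
  θ-iter (suc t) e = trans (θ-conjugates (iter G t e)) (cong step (θ-iter t e))

  hub : Entry n 7 r₀
  hub = entry-in-row zero 0F

  θ-hub : θ hub ≡ b₀
  θ-hub = cong toState (Inverse.strictlyInverseˡ rowCoords (zero , 0F))

  to-hub : ∀ e → Reaches G e hub
  to-hub e = t , θ-injective (trans (θ-iter t e) (trans stepᵗθe≡b₀ (sym θ-hub)))
    where
    i = toℕ (rowOf e)
    θe↝b₀ : θ e ↝ b₀
    θe↝b₀ = reaches-b₀ i (parity i) (offset e) (toℕ<n (rowOf e)) refl
    t = proj₁ θe↝b₀
    stepᵗθe≡b₀ = proj₂ θe↝b₀

  compatible : Compatible ωr ωc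
  compatible = hub⇒single-cycle G-injective hub to-hub


¬2∣7+u⇒u-even : ∀ u → ¬ 2 ∣ (7 + u) → parity u ≡ 0ℙ
¬2∣7+u⇒u-even u odd with parity u in u-parity
... | 0ℙ = refl
... | 1ℙ = ⊥-elim (odd (parity≡0ℙ⇒2∣ (7 + u) (trans (parity-suc u) (cong _⁻¹ u-parity))))

proposition3p6 : (n : ℕ) .{{_ : NonZero n}} → 7 ≤ n → ¬ (2 ∣ n) →
    (r₀ : Fin n) →
    Σ[ ωr ∈ RowOrdering n 7 r₀ ] Σ[ ωc ∈ ColumnOrdering n 7 r₀ ] Compatible ωr ωc
proposition3p6 n 7≤n odd r₀ with m≤n⇒∃[o]m+o≡n 7≤n
... | u , refl = ωr , ωc , compatible
  where open Construction u (¬2∣7+u⇒u-even u odd) r₀
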